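{- Let $p$ be an odd prime. Then the subgroup $\langle 2\rangle\subseteq\mathbb{F}_p^*$ generated by $2$ is $\mathrm{ord}_2(p)$ combinatorially nice.
   Context: For an odd prime $p$, $\mathrm{ord}_2(p)$ is the smallest positive integer $t$ with $p\mid 2^t-1$. $(u,v)=\sum_i u_iv_i$ is the dot product on $\mathbb{F}_q^m$. A set $S\subseteq\mathbb{F}_q^*$ is called $t$ combinatorially nice if for some constant $c>0$ and every positive integer $m$ there exist two collections of $n=\lfloor cm^t\rfloor$ vectors $u_1,\dots,u_n$ and $v_1,\dots,v_n$ in $\mathbb{F}_q^m$ such that $(u_i,v_i)=0$ for all $i\in[n]$ and $(u_j,v_i)\in S$ for all $i\ne j$ in $[n]$. -}

module Defs where

open import Data.Nat using (ℕ; zero; suc; _+_; _*_; _∸_; _^_; _≤_; _<_; NonZero)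
open import Data.Nat.DivMod using (_%_; _/_)
open import Data.Nat.Divisibility using (_∣_)
open import Data.Fin using (Fin; toℕ)
import Data.Fin as F
open import Data.Product using (Σ; ∃; _×_)
open import Relation.Binary.PropositionalEquality using (_≡_; _≢_)

sumFin : (m : ℕ) → (Fin m → ℕ) → ℕ
sumFin zero    f = 0
sumFin (suc m) f = f F.zero + sumFin m (λ i → f (F.suc i))

-- elements of F_p are represented by Fin p (residues 0..p-1)
-- dot product on F_p^m, returned as a residue in {0,...,p-1}
dot : (p : ℕ) .{{_ : NonZero p}} {m : ℕ} → (Fin m → Fin p) → (Fin m → Fin p) → ℕ
dot p {m} u v = sumFin m (λ k → toℕ (u k) * toℕ (v k)) % p

IsOrd2 : ℕ → ℕ → Set
IsOrd2 p t = (0 < t) × (p ∣ (2 ^ t ∸ 1)) × (∀ s → 0 < s → p ∣ (2 ^ s ∸ 1) → t ≤ s)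

InPowersOf2 : (p : ℕ) .{{_ : NonZero p}} → ℕ → Set
InPowersOf2 p r = ∃ λ k → r ≡ (2 ^ k) % p

-- The constant c > 0 is represented as a positive rational a / b
-- (equivalent to a positive real constant); n = ⌊ (a/b) m^t ⌋.
CombinatoriallyNice : (p : ℕ) .{{_ : NonZero p}} → (ℕ → Set) → ℕ → Set
CombinatoriallyNice p S t =
  Σ ℕ λ a → Σ ℕ λ b → Σ (0 < a) λ _ → Σ (0 < b) λ _ → Σ (NonZero b) λ nzb →
    ∀ m → 0 < m →
      let n = ((a * m ^ t) / b) {{nzb}} in
      Σ (Fin n → Fin m → Fin p) λ u → Σ (Fin n → Fin m → Fin p) λ v →
        (∀ i → dot p (u i) (v i) ≡ 0) ×
        (∀ i j → i ≢ j → S (dot p (u j) (v i)))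

module Submission where

-- Let T = p − 1 and e = T / t. A word α ∈ [N]^T is encoded by vectors x α, y α ∈ F_p^(1+TN) with
-- ⟨x α, y β⟩ = d(α, β), the Hamming distance (this uses p − 1 ≡ −1). Their e-th tensor powers
-- X α, Y α satisfy ⟨X α, Y β⟩ = d(α, β)^e, which vanishes for α = β. For α ≠ β we have 0 < d < p,
-- so (d^e)^t = d^(p−1) = 1 by Fermat, and every t-th root of unity mod p is a power of 2, since
-- 2 already has order t. Choosing N maximal with (1 + TN)^e ≤ m gives N^T ≥ m^t / (3T)^T words.

open import Data.Nat
open import Data.Nat.Properties
open import Data.Nat.DivMod
open import Data.Nat.Divisibility
open import Data.Nat.Primality using (Prime; euclidsLemma; prime⇒nonTrivial)
open import Data.Nat.Combinatorics
  using (_C_; nCk≡n!/k![n-k]!; k>n⇒nCk≡0; nCk+nC[k+1]≡[n+1]C[k+1]; nCn≡1; k![n∸k]!∣n!)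
open import Data.Fin using (Fin; toℕ; fromℕ<)
open import Data.Fin.Properties using (any?; toℕ-fromℕ<; toℕ<n; toℕ-injective)
open import Data.Product using (Σ; ∃; _×_; _,_; proj₁; proj₂)
open import Data.Sum using (_⊎_; inj₁; inj₂)
open import Data.Empty using (⊥-elim)
open import Relation.Nullary using (¬_; yes; no)
open import Relation.Binary.PropositionalEquality
open import Algebra.Properties.CommutativeSemigroup +-commutativeSemigroup
  using () renaming (interchange to +-interchange)
open import Algebra.Properties.CommutativeSemigroup *-commutativeSemigroup
  using () renaming (interchange to *-interchange; x∙yz≈y∙xz to *-x∙yz≈y∙xz)
open import Defs

-- Finite sums

∑ : ℕ → (ℕ → ℕ) → ℕ
∑ zero    f = 0
∑ (suc n) f = ∑ n f + f n

syntax ∑ n (λ k → e) = ∑[ k < n ] e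

∑-cong : ∀ n {f g : ℕ → ℕ} → (∀ k → k < n → f k ≡ g k) → ∑ n f ≡ ∑ n g
∑-cong zero    f≡g = refl
∑-cong (suc n) f≡g = cong₂ _+_ (∑-cong n (λ k k<n → f≡g k (m<n⇒m<1+n k<n))) (f≡g n ≤-refl)

∑-zero : ∀ n {f : ℕ → ℕ} → (∀ k → k < n → f k ≡ 0) → ∑ n f ≡ 0
∑-zero zero    f≡0 = refl
∑-zero (suc n) f≡0 = cong₂ _+_ (∑-zero n (λ k k<n → f≡0 k (m<n⇒m<1+n k<n))) (f≡0 n ≤-refl)

∑-const-1 : ∀ n → ∑[ _ < n ] 1 ≡ n
∑-const-1 zero    = refl
∑-const-1 (suc n) = trans (cong (_+ 1) (∑-const-1 n)) (+-comm n 1)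

∑-head : ∀ n f → ∑ (suc n) f ≡ f 0 + ∑[ k < n ] f (suc k)
∑-head zero    f = +-comm 0 (f 0)
∑-head (suc n) f = trans (cong (_+ f (suc n)) (∑-head n f)) (+-assoc (f 0) _ _)

∑-+ : ∀ a b f → ∑ (a + b) f ≡ ∑ a f + ∑[ k < b ] f (a + k)
∑-+ a zero    f = trans (cong (λ n → ∑ n f) (+-identityʳ a)) (sym (+-identityʳ _))
∑-+ a (suc b) f = begin
  ∑ (a + suc b) f                           ≡⟨ cong (λ n → ∑ n f) (+-suc a b) ⟩
  ∑ (a + b) f + f (a + b)                   ≡⟨ cong (_+ f (a + b)) (∑-+ a b f) ⟩
  ∑ a f + ∑[ k < b ] f (a + k) + f (a + b)  ≡⟨ +-assoc (∑ a f) _ _ ⟩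
  ∑ a f + ∑[ k < suc b ] f (a + k)          ∎
  where open ≡-Reasoning

∑-truncate : ∀ {M m} f → M ≤ m → (∀ k → M ≤ k → f k ≡ 0) → ∑ m f ≡ ∑ M f
∑-truncate {M} {m} f M≤m tail≡0 = begin
  ∑ m f                             ≡⟨ cong (λ n → ∑ n f) (m+[n∸m]≡n M≤m) ⟨
  ∑ (M + (m ∸ M)) f                 ≡⟨ ∑-+ M (m ∸ M) f ⟩
  ∑ M f + ∑[ k < m ∸ M ] f (M + k)  ≡⟨ cong (∑ M f +_) (∑-zero (m ∸ M) (λ k _ → tail≡0 _ (m≤m+n M k))) ⟩
  ∑ M f + 0                         ≡⟨ +-identityʳ _ ⟩
  ∑ M f                             ∎
  where open ≡-Reasoning

∑-distrib-+ : ∀ n f g → ∑[ k < n ] (f k + g k) ≡ ∑ n f + ∑ n g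
∑-distrib-+ zero    f g = refl
∑-distrib-+ (suc n) f g =
  trans (cong (_+ (f n + g n)) (∑-distrib-+ n f g)) (+-interchange (∑ n f) (∑ n g) (f n) (g n))

∑-*ˡ : ∀ n c f → ∑[ k < n ] (c * f k) ≡ c * ∑ n f
∑-*ˡ zero    c f = sym (*-zeroʳ c)
∑-*ˡ (suc n) c f = trans (cong (_+ c * f n) (∑-*ˡ n c f)) (sym (*-distribˡ-+ c (∑ n f) (f n)))

∑-*ʳ : ∀ n c f → ∑[ k < n ] (f k * c) ≡ ∑ n f * c
∑-*ʳ n c f = trans (∑-cong n (λ k _ → *-comm (f k) c)) (trans (∑-*ˡ n c f) (*-comm c _))

∑-comm : ∀ a b (f : ℕ → ℕ → ℕ) → ∑[ i < a ] ∑[ j < b ] f i j ≡ ∑[ j < b ] ∑[ i < a ] f i j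
∑-comm zero    b f = sym (∑-zero b (λ _ _ → refl))
∑-comm (suc a) b f =
  trans (cong (_+ ∑ b (f a)) (∑-comm a b f)) (sym (∑-distrib-+ b (λ j → ∑[ i < a ] f i j) (f a)))

∑-blocks : ∀ Q B f → ∑ (Q * B) f ≡ ∑[ q < Q ] ∑[ r < B ] f (q * B + r)
∑-blocks zero    B f = refl
∑-blocks (suc Q) B f = begin
  ∑ (B + Q * B) f                           ≡⟨ cong (λ n → ∑ n f) (+-comm B (Q * B)) ⟩
  ∑ (Q * B + B) f                           ≡⟨ ∑-+ (Q * B) B f ⟩
  ∑ (Q * B) f + ∑[ r < B ] f (Q * B + r)    ≡⟨ cong (_+ ∑[ r < B ] f (Q * B + r)) (∑-blocks Q B f) ⟩
  ∑[ q < suc Q ] ∑[ r < B ] f (q * B + r)   ∎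
  where open ≡-Reasoning

∑≡0⇒≡0 : ∀ n f → ∑ n f ≡ 0 → ∀ k → k < n → f k ≡ 0
∑≡0⇒≡0 (suc n) f ∑≡0 k k<1+n with m<1+n⇒m<n∨m≡n k<1+n
... | inj₁ k<n  = ∑≡0⇒≡0 n f (m+n≡0⇒m≡0 (∑ n f) ∑≡0) k k<n
... | inj₂ refl = m+n≡0⇒n≡0 (∑ n f) ∑≡0

sumFin≡∑ : ∀ m (f : ℕ → ℕ) → sumFin m (λ k → f (toℕ k)) ≡ ∑ m f
sumFin≡∑ zero    f = refl
sumFin≡∑ (suc m) f = trans (cong (f 0 +_) (sumFin≡∑ m (λ k → f (suc k)))) (sym (∑-head m f))

-- Elementary arithmetic

^-distribʳ-* : ∀ a b n → (a * b) ^ n ≡ a ^ n * b ^ n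
^-distribʳ-* a b zero    = refl
^-distribʳ-* a b (suc n) =
  trans (cong (a * b *_) (^-distribʳ-* a b n)) (*-interchange a b (a ^ n) (b ^ n))

^-comm : ∀ a m n → (a ^ m) ^ n ≡ (a ^ n) ^ m
^-comm a m n = trans (^-*-assoc a m n) (trans (cong (a ^_) (*-comm m n)) (sym (^-*-assoc a n m)))

[q*n+r]%n≡r : ∀ q {r} n .{{_ : NonZero n}} → r < n → (q * n + r) % n ≡ r
[q*n+r]%n≡r q n r<n = trans (%-remove-+ˡ _ (n∣m*n q)) (m<n⇒m%n≡m r<n)

[q*n+r]/n≡q : ∀ q {r} n .{{_ : NonZero n}} → r < n → (q * n + r) / n ≡ q
[q*n+r]/n≡q q {r} n r<n = begin
  (q * n + r) / n      ≡⟨ +-distrib-/-∣ˡ r (n∣m*n q) ⟩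
  q * n / n + r / n    ≡⟨ cong₂ _+_ (m*n/n≡m q n) (m<n⇒m/n≡0 r<n) ⟩
  q + 0                ≡⟨ +-identityʳ q ⟩
  q                    ∎
  where open ≡-Reasoning

binomial : ∀ n x → (x + 1) ^ n ≡ ∑[ k < suc n ] ((n C k) * x ^ k)
binomial zero    x = refl
binomial (suc n) x = begin
  (x + 1) * (x + 1) ^ n                             ≡⟨ cong ((x + 1) *_) (binomial n x) ⟩
  (x + 1) * S                                       ≡⟨ *-distribʳ-+ S x 1 ⟩
  x * S + 1 * S                                     ≡⟨ cong₂ _+_ x*S (trans (*-identityˡ S) S≡1+∑high) ⟩
  ∑ (suc n) low + (1 + ∑ (suc n) high)              ≡⟨ +-suc (∑ (suc n) low) _ ⟩
  1 + (∑ (suc n) low + ∑ (suc n) high)              ≡⟨ cong (1 +_) (∑-distrib-+ (suc n) low high) ⟨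
  1 + ∑[ k < suc n ] (low k + high k)               ≡⟨ cong (1 +_) (∑-cong (suc n) (λ k _ → pascal k)) ⟩
  1 + ∑[ k < suc n ] ((suc n C suc k) * x ^ suc k)  ≡⟨ ∑-head (suc n) (λ k → (suc n C k) * x ^ k) ⟨
  ∑[ k < suc (suc n) ] ((suc n C k) * x ^ k)        ∎
  where
  open ≡-Reasoning
  S = ∑[ k < suc n ] ((n C k) * x ^ k)
  low high : ℕ → ℕ
  low  k = (n C k) * x ^ suc k
  high k = (n C suc k) * x ^ suc k
  x*S : x * S ≡ ∑ (suc n) low
  x*S = trans (sym (∑-*ˡ (suc n) x (λ k → (n C k) * x ^ k)))
              (∑-cong (suc n) (λ k _ → *-x∙yz≈y∙xz x (n C k) (x ^ k)))
  S≡1+∑high : S ≡ 1 + ∑ (suc n) high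
  S≡1+∑high = begin
    S                                       ≡⟨ +-identityʳ S ⟨
    S + 0                                   ≡⟨ cong (λ c → S + c * x ^ suc n) (k>n⇒nCk≡0 (n<1+n n)) ⟨
    ∑[ k < suc (suc n) ] ((n C k) * x ^ k)  ≡⟨ ∑-head (suc n) (λ k → (n C k) * x ^ k) ⟩
    1 + ∑ (suc n) high                      ∎
  pascal : ∀ k → low k + high k ≡ (suc n C suc k) * x ^ suc k
  pascal k = trans (sym (*-distribʳ-+ (x ^ suc k) (n C k) (n C suc k)))
                   (cong (_* x ^ suc k) (nCk+nC[k+1]≡[n+1]C[k+1] n k))

binomial-ends : ∀ n x → (x + 1) ^ suc n ≡ 1 + ∑[ k < n ] ((suc n C suc k) * x ^ suc k) + x ^ suc n
binomial-ends n x = begin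
  (x + 1) ^ suc n                                                  ≡⟨ binomial (suc n) x ⟩
  ∑[ k < suc n ] ((suc n C k) * x ^ k) + (suc n C suc n) * x ^ suc n
    ≡⟨ cong₂ _+_ (∑-head n _) (trans (cong (_* x ^ suc n) (nCn≡1 (suc n))) (*-identityˡ (x ^ suc n))) ⟩
  1 + ∑[ k < n ] ((suc n C suc k) * x ^ suc k) + x ^ suc n         ∎
  where open ≡-Reasoning

geometric : ∀ z n → 1 + z * (∑[ k < n ] (z ^ k)) ≡ z ^ n + ∑[ k < n ] (z ^ k)
geometric z zero    = cong (1 +_) (*-zeroʳ z)
geometric z (suc n) = begin
  1 + z * (G + z ^ n)          ≡⟨ cong (1 +_) (*-distribˡ-+ z G (z ^ n)) ⟩
  1 + (z * G + z ^ suc n)      ≡⟨ +-assoc 1 (z * G) _ ⟨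
  1 + z * G + z ^ suc n        ≡⟨ cong (_+ z ^ suc n) (geometric z n) ⟩
  z ^ n + G + z ^ suc n        ≡⟨ cong (_+ z ^ suc n) (+-comm (z ^ n) G) ⟩
  G + z ^ n + z ^ suc n        ≡⟨ +-comm (G + z ^ n) _ ⟩
  z ^ suc n + (G + z ^ n)      ∎
  where
  open ≡-Reasoning
  G = ∑[ k < n ] (z ^ k)

n∣n! : ∀ {n} → 0 < n → n ∣ n !
n∣n! {suc n} _ = m∣m*n (n !)

nCk*k!*[n∸k]!≡n! : ∀ {n k} → k ≤ n → (n C k) * (k ! * (n ∸ k) !) ≡ n !
nCk*k!*[n∸k]!≡n! {n} {k} k≤n =
  trans (cong (_* (k ! * (n ∸ k) !)) (nCk≡n!/k![n-k]! k≤n)) (m/n*n≡m (k![n∸k]!∣n! k≤n))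
  where instance _ = k !* (n ∸ k) !≢0

0^n≡0 : ∀ {n} → 0 < n → 0 ^ n ≡ 0
0^n≡0 {suc _} _ = refl

crossing : ∀ (f : ℕ → ℕ) {m} d → f 0 ≤ m → m < f d → ∃ λ N → f N ≤ m × m < f (suc N)
crossing f zero    f0≤m m<f0 = ⊥-elim (<⇒≱ m<f0 f0≤m)
crossing f (suc d) f0≤m m<f[1+d] with f d ≤? _
... | yes fd≤m = d , fd≤m , m<f[1+d]
... | no  fd≰m = crossing f d f0≤m (≰⇒> fd≰m)

-- Congruences modulo p

module Modular (p : ℕ) .{{_ : NonZero p}} where

  infix 4 _≈_
  _≈_ : ℕ → ℕ → Set
  a ≈ b = a % p ≡ b % p

  %p≈ : ∀ a → a % p ≈ a
  %p≈ a = m%n%n≡m%n a p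

  ≈-+ : ∀ {a b c d} → a ≈ b → c ≈ d → a + c ≈ b + d
  ≈-+ {a} {b} {c} {d} a≈b c≈d = begin
    (a + c) % p            ≡⟨ %-distribˡ-+ a c p ⟩
    (a % p + c % p) % p    ≡⟨ cong₂ (λ x y → (x + y) % p) a≈b c≈d ⟩
    (b % p + d % p) % p    ≡⟨ %-distribˡ-+ b d p ⟨
    (b + d) % p            ∎
    where open ≡-Reasoning

  ≈-* : ∀ {a b c d} → a ≈ b → c ≈ d → a * c ≈ b * d
  ≈-* {a} {b} {c} {d} a≈b c≈d = begin
    (a * c) % p              ≡⟨ %-distribˡ-* a c p ⟩
    (a % p * (c % p)) % p    ≡⟨ cong₂ (λ x y → (x * y) % p) a≈b c≈d ⟩
    (b % p * (d % p)) % p    ≡⟨ %-distribˡ-* b d p ⟨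
    (b * d) % p              ∎
    where open ≡-Reasoning

  ≈-^ : ∀ {a b} n → a ≈ b → a ^ n ≈ b ^ n
  ≈-^ zero    a≈b = refl
  ≈-^ (suc n) a≈b = ≈-* a≈b (≈-^ n a≈b)

  ≈-∑ : ∀ n {f g : ℕ → ℕ} → (∀ k → k < n → f k ≈ g k) → ∑ n f ≈ ∑ n g
  ≈-∑ zero    f≈g = refl
  ≈-∑ (suc n) f≈g = ≈-+ (≈-∑ n (λ k k<n → f≈g k (m<n⇒m<1+n k<n))) (f≈g n ≤-refl)

  ∑≈0 : ∀ n {f : ℕ → ℕ} → (∀ k → k < n → f k ≈ 0) → ∑ n f ≈ 0
  ∑≈0 n f≈0 = trans (≈-∑ n f≈0) (cong (_% p) (∑-zero n (λ _ _ → refl)))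

  ∑≈head : ∀ {n} f → 0 < n → (∀ k → 0 < k → k < n → f k ≈ 0) → ∑ n f ≈ f 0
  ∑≈head {suc n} f _ f≈0 = begin
    ∑ (suc n) f % p                  ≡⟨ cong (_% p) (∑-head n f) ⟩
    (f 0 + ∑[ k < n ] f (suc k)) % p ≡⟨ ≈-+ {f 0} refl (∑≈0 n (λ k k<n → f≈0 (suc k) z<s (s<s k<n))) ⟩
    (f 0 + 0) % p                    ≡⟨ cong (_% p) (+-identityʳ (f 0)) ⟩
    f 0 % p                          ∎
    where open ≡-Reasoning

  ≈⇒∣∸ : ∀ {x y} → x ≈ y → p ∣ x ∸ y
  ≈⇒∣∸ {x} {y} x≈y = divides (x / p ∸ y / p) (begin
    x ∸ y                                      ≡⟨ cong₂ _∸_ (m≡m%n+[m/n]*n x p) (m≡m%n+[m/n]*n y p) ⟩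
    (x % p + x / p * p) ∸ (y % p + y / p * p)  ≡⟨ cong (λ r → (r + x / p * p) ∸ (y % p + y / p * p)) x≈y ⟩
    (y % p + x / p * p) ∸ (y % p + y / p * p)  ≡⟨ [m+n]∸[m+o]≡n∸o (y % p) _ _ ⟩
    x / p * p ∸ y / p * p                      ≡⟨ *-distribʳ-∸ p (x / p) (y / p) ⟨
    (x / p ∸ y / p) * p                        ∎)
    where open ≡-Reasoning

  ∣∸⇒≈ : ∀ {x y} → y ≤ x → p ∣ x ∸ y → x ≈ y
  ∣∸⇒≈ {x} {y} y≤x (divides q x∸y≡q*p) = begin
    x % p            ≡⟨ cong (_% p) (m+[n∸m]≡n y≤x) ⟨
    (y + (x ∸ y)) % p ≡⟨ cong (λ z → (y + z) % p) x∸y≡q*p ⟩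
    (y + q * p) % p  ≡⟨ [m+kn]%n≡m%n y q p ⟩
    y % p            ∎
    where open ≡-Reasoning

  0%p≡0 : 0 % p ≡ 0
  0%p≡0 = m<n⇒m%n≡m (>-nonZero⁻¹ p)

  ∣⇒≈0 : ∀ {x} → p ∣ x → x ≈ 0
  ∣⇒≈0 {x} p∣x = trans (n∣m⇒m%n≡0 x p p∣x) (sym 0%p≡0)

  ∣∸∧∣∸⇒≈ : ∀ {x y} → p ∣ x ∸ y → p ∣ y ∸ x → x ≈ y
  ∣∸∧∣∸⇒≈ {x} {y} p∣x∸y p∣y∸x with ≤-total y x
  ... | inj₁ y≤x = ∣∸⇒≈ y≤x p∣x∸y
  ... | inj₂ x≤y = sym (∣∸⇒≈ x≤y p∣y∸x)

  ≈-cancelˡ-+ : ∀ c {a b} → c + a ≈ c + b → a ≈ b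
  ≈-cancelˡ-+ c {a} {b} c+a≈c+b = ∣∸∧∣∸⇒≈ (p∣∸ c+a≈c+b) (p∣∸ (sym c+a≈c+b))
    where
    p∣∸ : ∀ {a b} → c + a ≈ c + b → p ∣ a ∸ b
    p∣∸ {a} {b} c+a≈c+b = subst (p ∣_) ([m+n]∸[m+o]≡n∸o c a b) (≈⇒∣∸ c+a≈c+b)

  RootOfUnity : ℕ → ℕ → Set
  RootOfUnity n x = x ^ n ≈ 1

  ≈1⇒^≈1 : ∀ {x} a → x ≈ 1 → x ^ a ≈ 1
  ≈1⇒^≈1 a x≈1 = trans (≈-^ a x≈1) (cong (_% p) (^-zeroˡ a))

  root-^ : ∀ {n x} a → RootOfUnity n x → RootOfUnity n (x ^ a)
  root-^ {n} {x} a xⁿ≈1 = trans (cong (_% p) (^-comm x a n)) (≈1⇒^≈1 a xⁿ≈1)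

  root-* : ∀ {n x y} → RootOfUnity n x → RootOfUnity n y → RootOfUnity n (x * y)
  root-* {n} {x} {y} xⁿ≈1 yⁿ≈1 = trans (cong (_% p) (^-distribʳ-* x y n)) (≈-* xⁿ≈1 yⁿ≈1)

  dot-mod : ∀ m (X Y : ℕ → ℕ) →
            dot p {m} (λ k → X (toℕ k) mod p) (λ k → Y (toℕ k) mod p) ≡ ∑[ c < m ] (X c * Y c) % p
  dot-mod m X Y = trans (cong (_% p) (sumFin≡∑ m (λ c → toℕ (X c mod p) * toℕ (Y c mod p))))
    (≈-∑ m (λ c _ → trans (cong (_% p) (cong₂ _*_ (toℕ-fromℕ< (m%n<n (X c) p)) (toℕ-fromℕ< (m%n<n (Y c) p))))
                          (≈-* (%p≈ (X c)) (%p≈ (Y c)))))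

module PrimeModulus (p : ℕ) .{{_ : NonZero p}} (p-prime : Prime p) where
  open Modular p

  1<p : 1 < p
  1<p = nonTrivial⇒n>1 p {{prime⇒nonTrivial p-prime}}

  0<p∸1 : 0 < p ∸ 1
  0<p∸1 = m<n⇒0<n∸m 1<p

  p≡1+[p∸1] : p ≡ suc (p ∸ 1)
  p≡1+[p∸1] = sym (m+[n∸m]≡n (<⇒≤ 1<p))

  0<n<p⇒p∤n : ∀ {n} → 0 < n → n < p → ¬ p ∣ n
  0<n<p⇒p∤n {suc _} _ n<p p∣n = <⇒≱ n<p (∣⇒≤ p∣n)

  n<p⇒p∤n! : ∀ {n} → n < p → ¬ p ∣ n !
  n<p⇒p∤n! {zero}  _   p∣1       = <⇒≢ 1<p (sym (∣1⇒≡1 p∣1))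
  n<p⇒p∤n! {suc n} n<p p∣[1+n]*n! with euclidsLemma (suc n) (n !) p-prime p∣[1+n]*n!
  ... | inj₁ p∣1+n = 0<n<p⇒p∤n z<s n<p p∣1+n
  ... | inj₂ p∣n!  = n<p⇒p∤n! (<-trans (n<1+n n) n<p) p∣n!

  p∣pCk : ∀ {k} → 0 < k → k < p → p ∣ p C k
  p∣pCk {k} 0<k k<p = p∣pCk-or-factorial (euclidsLemma (p C k) (k ! * (p ∸ k) !) p-prime p∣product)
    where
    p∣product : p ∣ (p C k) * (k ! * (p ∸ k) !)
    p∣product = subst (p ∣_) (sym (nCk*k!*[n∸k]!≡n! (<⇒≤ k<p))) (n∣n! (<-trans z<s 1<p))
    p∣pCk-or-factorial : p ∣ p C k ⊎ p ∣ k ! * (p ∸ k) ! → p ∣ p C k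
    p∣pCk-or-factorial (inj₁ p∣pCk) = p∣pCk
    p∣pCk-or-factorial (inj₂ p∣k!*[p∸k]!) with euclidsLemma (k !) ((p ∸ k) !) p-prime p∣k!*[p∸k]!
    ... | inj₁ p∣k!     = ⊥-elim (n<p⇒p∤n! k<p p∣k!)
    ... | inj₂ p∣[p∸k]! = ⊥-elim (n<p⇒p∤n! (∸-monoʳ-< {p} {k} {0} 0<k (<⇒≤ k<p)) p∣[p∸k]!)

  fermat : ∀ d → d ^ p ≈ d
  fermat zero    = cong (_% p) (0^n≡0 (<-trans z<s 1<p))
  fermat (suc d) = begin
    suc d ^ p % p                                  ≡⟨ cong (λ x → x ^ p % p) (+-comm 1 d) ⟩
    (d + 1) ^ p % p                                ≡⟨ cong (λ n → (d + 1) ^ n % p) p≡1+[p∸1] ⟩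
    (d + 1) ^ suc q % p                            ≡⟨ cong (_% p) (binomial-ends q d) ⟩
    (1 + middle + d ^ suc q) % p                   ≡⟨ ≈-+ (≈-+ {1} refl middle≈0) d^[1+q]≈d ⟩
    (1 + 0 + d) % p                                ∎
    where
    open ≡-Reasoning
    q = p ∸ 1
    middle = ∑[ k < q ] ((suc q C suc k) * d ^ suc k)
    p∣[1+q]C[1+k] : ∀ {k} → k < q → p ∣ suc q C suc k
    p∣[1+q]C[1+k] {k} k<q = subst (λ n → p ∣ n C suc k) p≡1+[p∸1]
      (p∣pCk z<s (subst (suc k <_) (sym p≡1+[p∸1]) (s<s k<q)))
    middle≈0 : middle ≈ 0
    middle≈0 = ∑≈0 q (λ k k<q → ∣⇒≈0 (∣m⇒∣m*n (d ^ suc k) (p∣[1+q]C[1+k] k<q)))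
    d^[1+q]≈d : d ^ suc q ≈ d
    d^[1+q]≈d = trans (cong (λ n → d ^ n % p) (sym p≡1+[p∸1])) (fermat d)

  *-cancelˡ-≈ : ∀ {d x y} → ¬ p ∣ d → d * x ≈ d * y → x ≈ y
  *-cancelˡ-≈ {d} p∤d dx≈dy = ∣∸∧∣∸⇒≈ (p∣∸ dx≈dy) (p∣∸ (sym dx≈dy))
    where
    p∣∸ : ∀ {x y} → d * x ≈ d * y → p ∣ x ∸ y
    p∣∸ {x} {y} dx≈dy with euclidsLemma d (x ∸ y) p-prime
                                (subst (p ∣_) (sym (*-distribˡ-∸ d x y)) (≈⇒∣∸ dx≈dy))
    ... | inj₁ p∣d   = ⊥-elim (p∤d p∣d)
    ... | inj₂ p∣x∸y = p∣x∸y

  fermat′ : ∀ {d} → ¬ p ∣ d → d ^ (p ∸ 1) ≈ 1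
  fermat′ {d} p∤d = *-cancelˡ-≈ p∤d (begin
    d * d ^ (p ∸ 1) % p   ≡⟨ cong (λ n → d ^ n % p) p≡1+[p∸1] ⟨
    d ^ p % p             ≡⟨ fermat d ⟩
    d % p                 ≡⟨ cong (_% p) (*-identityʳ d) ⟨
    d * 1 % p             ∎)
    where open ≡-Reasoning

  geometric≈0 : ∀ {z} n → RootOfUnity n z → ¬ z ≈ 1 → ∑[ k < n ] (z ^ k) ≈ 0
  geometric≈0 {z} n zⁿ≈1 z≉1 with p ∣? ∑[ k < n ] (z ^ k)
  ... | yes p∣G = ∣⇒≈0 p∣G
  ... | no  p∤G = ⊥-elim (z≉1 (*-cancelˡ-≈ p∤G G*z≈G*1))
    where
    G = ∑[ k < n ] (z ^ k)
    z*G≈G : z * G ≈ G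
    z*G≈G = ≈-cancelˡ-+ 1 (trans (cong (_% p) (geometric z n)) (≈-+ zⁿ≈1 refl))
    G*z≈G*1 : G * z ≈ G * 1
    G*z≈G*1 = trans (cong (_% p) (*-comm G z)) (trans z*G≈G (cong (_% p) (sym (*-identityʳ G))))

-- Hamming distance, digits and tensor powers

δ : ℕ → ℕ → ℕ
δ a b with a ≟ b
... | yes _ = 1
... | no  _ = 0

δ-refl : ∀ a → δ a a ≡ 1
δ-refl a with a ≟ a
... | yes _   = refl
... | no  a≢a = ⊥-elim (a≢a refl)

δ-≢ : ∀ {a b} → a ≢ b → δ a b ≡ 0
δ-≢ {a} {b} a≢b with a ≟ b
... | yes a≡b = ⊥-elim (a≢b a≡b)
... | no  _   = refl

δ≤1 : ∀ a b → δ a b ≤ 1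
δ≤1 a b with a ≟ b
... | yes _ = s≤s z≤n
... | no  _ = z≤n

δ>0⇒≡ : ∀ {a b} → 0 < δ a b → a ≡ b
δ>0⇒≡ {a} {b} 0<δ with a ≟ b
... | yes a≡b = a≡b

∑-δ*δ : ∀ N {a} b → a < N → ∑[ r < N ] (δ r a * δ r b) ≡ δ a b
∑-δ*δ (suc N) {a} b a<1+N with m<1+n⇒m<n∨m≡n a<1+N
... | inj₁ a<N  = trans (cong₂ _+_ (∑-δ*δ N b a<N) (cong (_* δ N b) (δ-≢ (>⇒≢ a<N))))
                        (+-identityʳ (δ a b))
... | inj₂ refl = trans (cong₂ _+_ (∑-zero N (λ r r<N → cong (_* δ r b) (δ-≢ (<⇒≢ r<N))))
                                   (cong (_* δ N b) (δ-refl N)))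
                        (+-identityʳ (δ N b))

agreements hamming : ℕ → (ℕ → ℕ) → (ℕ → ℕ) → ℕ
agreements T α β = ∑[ q < T ] δ (α q) (β q)
hamming    T α β = ∑[ q < T ] (1 ∸ δ (α q) (β q))

agreements+hamming≡T : ∀ T α β → agreements T α β + hamming T α β ≡ T
agreements+hamming≡T T α β = begin
  agreements T α β + hamming T α β                  ≡⟨ ∑-distrib-+ T _ _ ⟨
  ∑[ q < T ] (δ (α q) (β q) + (1 ∸ δ (α q) (β q)))  ≡⟨ ∑-cong T (λ q _ → m+[n∸m]≡n (δ≤1 (α q) (β q))) ⟩
  ∑[ _ < T ] 1                                      ≡⟨ ∑-const-1 T ⟩
  T                                                 ∎
  where open ≡-Reasoning

hamming≤T : ∀ T α β → hamming T α β ≤ T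
hamming≤T T α β = subst (hamming T α β ≤_) (agreements+hamming≡T T α β) (m≤n+m _ _)

hamming-self : ∀ T α → hamming T α α ≡ 0
hamming-self T α = ∑-zero T (λ q _ → cong (1 ∸_) (δ-refl (α q)))

hamming≡0⇒≡ : ∀ T α β → hamming T α β ≡ 0 → ∀ q → q < T → α q ≡ β q
hamming≡0⇒≡ T α β h≡0 q q<T = δ>0⇒≡ (m∸n≡0⇒m≤n (∑≡0⇒≡0 T _ h≡0 q q<T))

module Digits (N : ℕ) .{{_ : NonZero N}} where

  digit : ℕ → ℕ → ℕ
  digit x zero    = x % N
  digit x (suc r) = digit (x / N) r

  digit<N : ∀ x r → digit x r < N
  digit<N x zero    = m%n<n x N
  digit<N x (suc r) = digit<N (x / N) r

  digits-injective : ∀ T {x y} → x < N ^ T → y < N ^ T →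
                     (∀ r → r < T → digit x r ≡ digit y r) → x ≡ y
  digits-injective zero    {x} {y} x<1 y<1 _ = trans (n<1⇒n≡0 x<1) (sym (n<1⇒n≡0 y<1))
  digits-injective (suc T) {x} {y} x<N^[1+T] y<N^[1+T] same = begin
    x                  ≡⟨ m≡m%n+[m/n]*n x N ⟩
    x % N + x / N * N  ≡⟨ cong₂ (λ a b → a + b * N) (same 0 z<s) quotients≡ ⟩
    y % N + y / N * N  ≡⟨ m≡m%n+[m/n]*n y N ⟨
    y                  ∎
    where
    open ≡-Reasoning
    /N<N^T : ∀ {z} → z < N ^ suc T → z / N < N ^ T
    /N<N^T {z} z< = m<n*o⇒m/o<n (subst (z <_) (*-comm N (N ^ T)) z<)
    quotients≡ : x / N ≡ y / N
    quotients≡ = digits-injective T (/N<N^T x<N^[1+T]) (/N<N^T y<N^[1+T]) (λ r r<T → same (suc r) (s<s r<T))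

module TensorPower (B : ℕ) .{{_ : NonZero B}} where

  -- The k-th coordinate of the e-fold tensor power of f ∈ ℕ^B, with k read in base B.
  tensor : ℕ → (ℕ → ℕ) → ℕ → ℕ
  tensor zero    f k = δ k 0
  tensor (suc e) f k = f (k % B) * tensor e f (k / B)

  tensor-vanishes : ∀ e f {k} → B ^ e ≤ k → tensor e f k ≡ 0
  tensor-vanishes zero    f {k} 1≤k = δ-≢ (>⇒≢ 1≤k)
  tensor-vanishes (suc e) f {k} B*B^e≤k =
    trans (cong (f (k % B) *_) (tensor-vanishes e f B^e≤k/B)) (*-zeroʳ (f (k % B)))
    where
    B^e≤k/B : B ^ e ≤ k / B
    B^e≤k/B = subst (_≤ k / B) (m*n/n≡m (B ^ e) B) (/-monoˡ-≤ B (subst (_≤ k) (*-comm B (B ^ e)) B*B^e≤k))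

  ∑-tensor : ∀ e f g → ∑[ k < B ^ e ] (tensor e f k * tensor e g k) ≡ (∑[ c < B ] (f c * g c)) ^ e
  ∑-tensor zero    f g = refl
  ∑-tensor (suc e) f g = begin
    ∑ (B * B ^ e) F                               ≡⟨ cong (λ n → ∑ n F) (*-comm B (B ^ e)) ⟩
    ∑ (B ^ e * B) F                               ≡⟨ ∑-blocks (B ^ e) B F ⟩
    ∑[ q < B ^ e ] ∑[ r < B ] F (q * B + r)       ≡⟨ ∑-cong (B ^ e) (λ q _ → block q) ⟩
    ∑[ q < B ^ e ] (S * P q)                      ≡⟨ ∑-*ˡ (B ^ e) S P ⟩
    S * ∑ (B ^ e) P                               ≡⟨ cong (S *_) (∑-tensor e f g) ⟩
    S * S ^ e                                     ∎
    where
    open ≡-Reasoning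
    F P : ℕ → ℕ
    F k = tensor (suc e) f k * tensor (suc e) g k
    P q = tensor e f q * tensor e g q
    S = ∑[ c < B ] (f c * g c)
    block : ∀ q → ∑[ r < B ] F (q * B + r) ≡ S * P q
    block q = begin
      ∑[ r < B ] F (q * B + r)         ≡⟨ ∑-cong B (λ r r<B → cong₂ (λ a b → f a * tensor e f b * (g a * tensor e g b))
                                            ([q*n+r]%n≡r q B r<B) ([q*n+r]/n≡q q B r<B)) ⟩
      ∑[ r < B ] (f r * tensor e f q * (g r * tensor e g q))
                                       ≡⟨ ∑-cong B (λ r _ → *-interchange (f r) (tensor e f q) (g r) (tensor e g q)) ⟩
      ∑[ r < B ] (f r * g r * P q)     ≡⟨ ∑-*ʳ B (P q) (λ r → f r * g r) ⟩
      S * P q                          ∎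

-- Coordinate 0 is constant; coordinate 1 + (q N + r) records whether the q-th letter is r.
module HammingGadget (p : ℕ) .{{_ : NonZero p}} (T N : ℕ) .{{_ : NonZero N}} where
  open Modular p

  x y : (ℕ → ℕ) → ℕ → ℕ
  x α zero    = 1
  x α (suc c) = δ (c % N) (α (c / N))
  y β zero    = T
  y β (suc c) = (p ∸ 1) * δ (c % N) (β (c / N))

  x·y≈hamming : ∀ α β → (∀ q → α q < N) → ∑[ c < suc (T * N) ] (x α c * y β c) ≈ hamming T α β
  x·y≈hamming α β α<N = begin
    ∑[ c < suc (T * N) ] (x α c * y β c) % p          ≡⟨ cong (_% p) (∑-head (T * N) g) ⟩
    (1 * T + ∑[ c < T * N ] g (suc c)) % p            ≡⟨ cong₂ (λ a b → (a + b) % p) (*-identityˡ T) blocks ⟩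
    (T + (p ∸ 1) * A) % p                             ≡⟨ cong (_% p) T+[p∸1]*A≡H+p*A ⟩
    (H + p * A) % p                                   ≡⟨ %-remove-+ʳ H (m∣m*n A) ⟩
    H % p                                             ∎
    where
    open ≡-Reasoning
    A = agreements T α β
    H = hamming T α β
    g : ℕ → ℕ
    g c = x α c * y β c
    coordinate : ∀ q r → r < N → g (suc (q * N + r)) ≡ (p ∸ 1) * (δ r (α q) * δ r (β q))
    coordinate q r r<N = begin
      δ (c % N) (α (c / N)) * ((p ∸ 1) * δ (c % N) (β (c / N)))
        ≡⟨ cong₂ (λ a b → δ a (α b) * ((p ∸ 1) * δ a (β b))) ([q*n+r]%n≡r q N r<N) ([q*n+r]/n≡q q N r<N) ⟩
      δ r (α q) * ((p ∸ 1) * δ r (β q))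
        ≡⟨ *-x∙yz≈y∙xz (δ r (α q)) (p ∸ 1) (δ r (β q)) ⟩
      (p ∸ 1) * (δ r (α q) * δ r (β q)) ∎
      where c = q * N + r
    blocks : ∑[ c < T * N ] g (suc c) ≡ (p ∸ 1) * A
    blocks = begin
      ∑[ c < T * N ] g (suc c)                                 ≡⟨ ∑-blocks T N (λ c → g (suc c)) ⟩
      ∑[ q < T ] ∑[ r < N ] g (suc (q * N + r))                ≡⟨ ∑-cong T (λ q _ → ∑-cong N (coordinate q)) ⟩
      ∑[ q < T ] ∑[ r < N ] ((p ∸ 1) * (δ r (α q) * δ r (β q)))
        ≡⟨ ∑-cong T (λ q _ → trans (∑-*ˡ N (p ∸ 1) _) (cong ((p ∸ 1) *_) (∑-δ*δ N (β q) (α<N q)))) ⟩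
      ∑[ q < T ] ((p ∸ 1) * δ (α q) (β q))                     ≡⟨ ∑-*ˡ T (p ∸ 1) _ ⟩
      (p ∸ 1) * A                                              ∎
    T+[p∸1]*A≡H+p*A : T + (p ∸ 1) * A ≡ H + p * A
    T+[p∸1]*A≡H+p*A = begin
      T + (p ∸ 1) * A        ≡⟨ cong (_+ (p ∸ 1) * A) (agreements+hamming≡T T α β) ⟨
      A + H + (p ∸ 1) * A    ≡⟨ cong (_+ (p ∸ 1) * A) (+-comm A H) ⟩
      H + A + (p ∸ 1) * A    ≡⟨ +-assoc H A _ ⟩
      H + suc (p ∸ 1) * A    ≡⟨ cong (λ n → H + n * A) (m+[n∸m]≡n (>-nonZero⁻¹ p)) ⟩
      H + p * A              ∎

-- The order of 2 and the construction

NiceFamily : (p : ℕ) .{{_ : NonZero p}} → (ℕ → Set) → ℕ → ℕ → Set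
NiceFamily p S m n =
  Σ (Fin n → Fin m → Fin p) λ u → Σ (Fin n → Fin m → Fin p) λ v →
    (∀ i → dot p (u i) (v i) ≡ 0) × (∀ i j → i ≢ j → S (dot p (u j) (v i)))

empty-family : ∀ {p} .{{_ : NonZero p}} S {m} → NiceFamily p S m 0
empty-family S = (λ ()) , (λ ()) , (λ ()) , (λ ())

module OrderOfTwo (p : ℕ) .{{_ : NonZero p}} (p-prime : Prime p) (p≢2 : p ≢ 2)
                  (t : ℕ) (ord : IsOrd2 p t) where
  open Modular p
  open PrimeModulus p p-prime

  0<t : 0 < t
  0<t = proj₁ ord

  2^t≈1 : RootOfUnity t 2
  2^t≈1 = ∣∸⇒≈ (m^n>0 2 t) (proj₁ (proj₂ ord))

  ord-minimal : ∀ {s} → 0 < s → RootOfUnity s 2 → t ≤ s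
  ord-minimal 0<s 2ˢ≈1 = proj₂ (proj₂ ord) _ 0<s (≈⇒∣∸ 2ˢ≈1)

  2^[r+q*t]≈2^r : ∀ r q → 2 ^ (r + q * t) ≈ 2 ^ r
  2^[r+q*t]≈2^r r q = begin
    2 ^ (r + q * t) % p         ≡⟨ cong (_% p) (^-distribˡ-+-* 2 r (q * t)) ⟩
    2 ^ r * 2 ^ (q * t) % p     ≡⟨ cong (λ n → 2 ^ r * 2 ^ n % p) (*-comm q t) ⟩
    2 ^ r * 2 ^ (t * q) % p     ≡⟨ cong (λ x → 2 ^ r * x % p) (^-*-assoc 2 t q) ⟨
    2 ^ r * (2 ^ t) ^ q % p     ≡⟨ ≈-* {2 ^ r} refl (≈1⇒^≈1 q 2^t≈1) ⟩
    2 ^ r * 1 % p               ≡⟨ cong (_% p) (*-identityʳ (2 ^ r)) ⟩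
    2 ^ r % p                   ∎
    where open ≡-Reasoning

  instance
    t≢0 : NonZero t
    t≢0 = >-nonZero 0<t

  p∤2 : ¬ p ∣ 2
  p∤2 p∣2 = p≢2 (≤-antisym (∣⇒≤ p∣2) 1<p)

  2^[p∸1]≈1 : RootOfUnity (p ∸ 1) 2
  2^[p∸1]≈1 = fermat′ p∤2

  t<p : t < p
  t<p = subst (t <_) (sym p≡1+[p∸1]) (s≤s (ord-minimal 0<p∸1 2^[p∸1]≈1))

  t∣p∸1 : t ∣ p ∸ 1
  t∣p∸1 = m%n≡0⇒n∣m (p ∸ 1) t [p∸1]%t≡0
    where
    2^[[p∸1]%t]≈1 : RootOfUnity ((p ∸ 1) % t) 2
    2^[[p∸1]%t]≈1 = begin
      2 ^ ((p ∸ 1) % t) % p                           ≡⟨ 2^[r+q*t]≈2^r ((p ∸ 1) % t) ((p ∸ 1) / t) ⟨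
      2 ^ ((p ∸ 1) % t + (p ∸ 1) / t * t) % p         ≡⟨ cong (λ n → 2 ^ n % p) (m≡m%n+[m/n]*n (p ∸ 1) t) ⟨
      2 ^ (p ∸ 1) % p                                 ≡⟨ 2^[p∸1]≈1 ⟩
      1 % p                                           ∎
      where open ≡-Reasoning
    [p∸1]%t≡0 : (p ∸ 1) % t ≡ 0
    [p∸1]%t≡0 with (p ∸ 1) % t in eq
    ... | zero  = refl
    ... | suc r = ⊥-elim (<⇒≱ (subst (_< t) eq (m%n<n (p ∸ 1) t))
                              (ord-minimal z<s (subst (λ s → RootOfUnity s 2) eq 2^[[p∸1]%t]≈1)))

  -- Summing (y 2^s)^j over s, j < t by columns gives t, and by rows gives 0 unless some y 2^s ≈ 1;
  -- as 0 < t < p, some y 2^s ≈ 1, whence y ≈ 2^((t − 1) s).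
  ∑-cosets≈t : ∀ {y} → RootOfUnity t y → ∑[ s < t ] ∑[ j < t ] ((y * 2 ^ s) ^ j) ≈ t
  ∑-cosets≈t {y} yᵗ≈1 = begin
    ∑[ s < t ] ∑[ j < t ] ((y * 2 ^ s) ^ j) % p   ≡⟨ cong (_% p) (∑-comm t t (λ s j → (y * 2 ^ s) ^ j)) ⟩
    ∑[ j < t ] ∑[ s < t ] ((y * 2 ^ s) ^ j) % p   ≡⟨ cong (_% p) (∑-cong t (λ j _ → column j)) ⟩
    ∑ t h % p                                     ≡⟨ ∑≈head h 0<t h≈0 ⟩
    h 0 % p                                       ≡⟨ cong (_% p) h0≡t ⟩
    t % p                                         ∎
    where
    open ≡-Reasoning
    h : ℕ → ℕ
    h j = y ^ j * ∑[ s < t ] ((2 ^ j) ^ s)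
    column : ∀ j → ∑[ s < t ] ((y * 2 ^ s) ^ j) ≡ h j
    column j = trans (∑-cong t (λ s _ → trans (^-distribʳ-* y (2 ^ s) j) (cong (y ^ j *_) (^-comm 2 s j))))
                     (∑-*ˡ t (y ^ j) (λ s → (2 ^ j) ^ s))
    h0≡t : h 0 ≡ t
    h0≡t = trans (*-identityˡ _) (trans (∑-cong t (λ s _ → ^-zeroˡ s)) (∑-const-1 t))
    h≈0 : ∀ j → 0 < j → j < t → h j ≈ 0
    h≈0 j 0<j j<t = trans (≈-* {y ^ j} refl (geometric≈0 {2 ^ j} t (root-^ {t} {2} j 2^t≈1) 2ʲ≉1))
                          (cong (_% p) (*-zeroʳ (y ^ j)))
      where
      2ʲ≉1 : ¬ 2 ^ j ≈ 1
      2ʲ≉1 2ʲ≈1 = <⇒≱ j<t (ord-minimal 0<j 2ʲ≈1)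

  ∑-cosets≈0 : ∀ {y} → RootOfUnity t y → (∀ s → s < t → ¬ y * 2 ^ s ≈ 1) →
               ∑[ s < t ] ∑[ j < t ] ((y * 2 ^ s) ^ j) ≈ 0
  ∑-cosets≈0 {y} yᵗ≈1 y2ˢ≉1 = ∑≈0 t (λ s s<t → geometric≈0 {y * 2 ^ s} t (y2ˢ-root s) (y2ˢ≉1 s s<t))
    where
    y2ˢ-root : ∀ s → RootOfUnity t (y * 2 ^ s)
    y2ˢ-root s = root-* {t} {y} yᵗ≈1 (root-^ {t} {2} s 2^t≈1)

  root⇒power-of-2 : ∀ {y} → RootOfUnity t y → InPowersOf2 p (y % p)
  root⇒power-of-2 {y} yᵗ≈1 with any? {n = t} (λ s → y * 2 ^ toℕ s % p ≟ 1 % p)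
  ... | no ∄s = ⊥-elim (<⇒≢ 0<t (sym t≡0))
    where
    y2ˢ≉1 : ∀ s → s < t → ¬ y * 2 ^ s ≈ 1
    y2ˢ≉1 s s<t y2ˢ≈1 = ∄s (fromℕ< s<t , subst (λ r → y * 2 ^ r ≈ 1) (sym (toℕ-fromℕ< s<t)) y2ˢ≈1)
    t≡0 : t ≡ 0
    t≡0 = begin
      t      ≡⟨ m<n⇒m%n≡m t<p ⟨
      t % p  ≡⟨ trans (sym (∑-cosets≈t yᵗ≈1)) (∑-cosets≈0 yᵗ≈1 y2ˢ≉1) ⟩
      0 % p  ≡⟨ 0%p≡0 ⟩
      0      ∎
      where open ≡-Reasoning
  ... | yes (s , y2ˢ≈1) = pred t * toℕ s , (begin
    y % p                                ≡⟨ cong (_% p) (*-identityʳ y) ⟨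
    y * 1 % p                            ≡⟨ ≈-* {y} refl (≈1⇒^≈1 S 2^t≈1) ⟨
    y * (2 ^ t) ^ S % p                  ≡⟨ cong (λ x → y * x % p) (^-*-assoc 2 t S) ⟩
    y * 2 ^ (t * S) % p                  ≡⟨ cong (λ n → y * 2 ^ (n * S) % p) (suc-pred t) ⟨
    y * 2 ^ (S + pred t * S) % p         ≡⟨ cong (λ x → y * x % p) (^-distribˡ-+-* 2 S (pred t * S)) ⟩
    y * (2 ^ S * 2 ^ (pred t * S)) % p   ≡⟨ cong (_% p) (*-assoc y (2 ^ S) _) ⟨
    y * 2 ^ S * 2 ^ (pred t * S) % p     ≡⟨ ≈-* y2ˢ≈1 refl ⟩
    1 * 2 ^ (pred t * S) % p             ≡⟨ cong (_% p) (*-identityˡ _) ⟩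
    2 ^ (pred t * S) % p                 ∎)
    where
    open ≡-Reasoning
    S = toℕ s

  e : ℕ
  e = quotient t∣p∸1

  p∸1≡e*t : p ∸ 1 ≡ e * t
  p∸1≡e*t = m∣n⇒n≡quotient*m t∣p∸1

  0<e : 0 < e
  0<e = n≢0⇒n>0 (λ e≡0 → <⇒≢ 0<p∸1 (sym (trans p∸1≡e*t (cong (_* t) e≡0))))

module Construction (p : ℕ) .{{_ : NonZero p}} (p-prime : Prime p) (p≢2 : p ≢ 2)
                    (t : ℕ) (ord : IsOrd2 p t) where
  open Modular p
  open PrimeModulus p p-prime
  open OrderOfTwo p p-prime p≢2 t ord

  instance
    p∸1≢0 : NonZero (p ∸ 1)
    p∸1≢0 = >-nonZero 0<p∸1

  dim : ℕ → ℕ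
  dim N = suc ((p ∸ 1) * N) ^ e

  module Family (N : ℕ) .{{_ : NonZero N}} (m n : ℕ)
                (dim≤m : dim N ≤ m) (n≤N^[p∸1] : n ≤ N ^ (p ∸ 1)) where
    open HammingGadget p (p ∸ 1) N
    open Digits N
    open TensorPower (suc ((p ∸ 1) * N))

    word : Fin n → ℕ → ℕ
    word i = digit (toℕ i)

    u v : Fin n → Fin m → Fin p
    u i k = tensor e (x (word i)) (toℕ k) mod p
    v i k = tensor e (y (word i)) (toℕ k) mod p

    dot≡hamming^e : ∀ i j → dot p (u j) (v i) ≡ hamming (p ∸ 1) (word j) (word i) ^ e % p
    dot≡hamming^e i j = begin
      dot p (u j) (v i)                                       ≡⟨ dot-mod m X Y ⟩
      ∑[ c < m ] (X c * Y c) % p                              ≡⟨ cong (_% p) (∑-truncate _ dim≤m X≡0) ⟩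
      ∑[ c < dim N ] (X c * Y c) % p                          ≡⟨ cong (_% p) (∑-tensor e _ _) ⟩
      (∑[ c < suc ((p ∸ 1) * N) ] (x (word j) c * y (word i) c)) ^ e % p
                                                              ≡⟨ ≈-^ e (x·y≈hamming (word j) (word i) (digit<N (toℕ j))) ⟩
      hamming (p ∸ 1) (word j) (word i) ^ e % p               ∎
      where
      open ≡-Reasoning
      X Y : ℕ → ℕ
      X = tensor e (x (word j))
      Y = tensor e (y (word i))
      X≡0 : ∀ c → dim N ≤ c → X c * Y c ≡ 0
      X≡0 c dim≤c = cong (_* Y c) (tensor-vanishes e _ dim≤c)

    diagonal : ∀ i → dot p (u i) (v i) ≡ 0
    diagonal i = begin
      dot p (u i) (v i)                          ≡⟨ dot≡hamming^e i i ⟩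
      hamming (p ∸ 1) (word i) (word i) ^ e % p  ≡⟨ cong (λ d → d ^ e % p) (hamming-self (p ∸ 1) (word i)) ⟩
      0 ^ e % p                                  ≡⟨ cong (_% p) (0^n≡0 0<e) ⟩
      0 % p                                      ≡⟨ 0%p≡0 ⟩
      0                                          ∎
      where open ≡-Reasoning

    off-diagonal : ∀ i j → i ≢ j → InPowersOf2 p (dot p (u j) (v i))
    off-diagonal i j i≢j = subst (InPowersOf2 p) (sym (dot≡hamming^e i j)) (root⇒power-of-2 dᵉ-root)
      where
      d = hamming (p ∸ 1) (word j) (word i)
      <N^[p∸1] : ∀ k → toℕ k < N ^ (p ∸ 1)
      <N^[p∸1] k = <-≤-trans (toℕ<n k) n≤N^[p∸1]
      d≢0 : d ≢ 0
      d≢0 d≡0 = i≢j (sym (toℕ-injective (digits-injective (p ∸ 1) (<N^[p∸1] j) (<N^[p∸1] i)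
                                           (hamming≡0⇒≡ (p ∸ 1) (word j) (word i) d≡0))))
      d<p : d < p
      d<p = subst (d <_) (sym p≡1+[p∸1]) (s≤s (hamming≤T (p ∸ 1) (word j) (word i)))
      dᵉ-root : RootOfUnity t (d ^ e)
      dᵉ-root = trans (cong (_% p) (trans (^-*-assoc d e t) (cong (d ^_) (sym p∸1≡e*t))))
                      (fermat′ (0<n<p⇒p∤n (n≢0⇒n>0 d≢0) d<p))

  nice-family : ∀ N m n → dim N ≤ m → n ≤ N ^ (p ∸ 1) → NiceFamily p (InPowersOf2 p) m n
  nice-family zero    m n _     n≤0^[p∸1] =
    subst (NiceFamily p (InPowersOf2 p) m) (sym n≡0) (empty-family (InPowersOf2 p))
    where
    n≡0 : n ≡ 0
    n≡0 = n≤0⇒n≡0 (subst (n ≤_) (0^n≡0 0<p∸1) n≤0^[p∸1])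
  nice-family (suc N) m n dim≤m n≤N^[p∸1] = u , v , diagonal , off-diagonal
    where open Family (suc N) m n dim≤m n≤N^[p∸1]

  dim[0]≤m : ∀ {m} → 0 < m → dim 0 ≤ m
  dim[0]≤m 0<m = subst (_≤ _) (sym (trans (cong (λ n → suc n ^ e) (*-zeroʳ (p ∸ 1))) (^-zeroˡ e))) 0<m

  m<dim[m] : ∀ m → m < dim m
  m<dim[m] m = begin-strict
    m                          ≤⟨ m≤n*m m (p ∸ 1) ⟩
    (p ∸ 1) * m                <⟨ n<1+n _ ⟩
    suc ((p ∸ 1) * m)          ≡⟨ *-identityʳ _ ⟨
    suc ((p ∸ 1) * m) ^ 1      ≤⟨ ^-monoʳ-≤ (suc ((p ∸ 1) * m)) 0<e ⟩
    dim m                      ∎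
    where open ≤-Reasoning

  -- If m < dim (1 + N) then m^t < (1 + (p − 1)(1 + N))^(p − 1) ≤ b · max(N, 1)^(p − 1).
  b : ℕ
  b = (3 * (p ∸ 1)) ^ (p ∸ 1)

  instance
    b≢0 : NonZero b
    b≢0 = m^n≢0 (3 * (p ∸ 1)) (p ∸ 1) {{m*n≢0 3 (p ∸ 1)}}

  1+[p∸1]*[1+N]≤3*[p∸1]*M : ∀ {N M} → 0 < M → N ≤ M → suc ((p ∸ 1) * suc N) ≤ 3 * (p ∸ 1) * M
  1+[p∸1]*[1+N]≤3*[p∸1]*M {N} {M} 0<M N≤M = begin
    suc ((p ∸ 1) * suc N)          ≡⟨ cong suc (*-suc (p ∸ 1) N) ⟩
    1 + ((p ∸ 1) + (p ∸ 1) * N)    ≤⟨ +-mono-≤ (*-mono-≤ 0<p∸1 0<M) (+-mono-≤ (m≤m*n (p ∸ 1) M)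
                                        (≤-trans (*-monoʳ-≤ (p ∸ 1) N≤M) (m≤m+n _ 0))) ⟩
    K + (K + (K + 0))              ≡⟨ *-assoc 3 (p ∸ 1) M ⟨
    3 * (p ∸ 1) * M                ∎
    where
    open ≤-Reasoning
    instance _ = >-nonZero 0<M
    K = (p ∸ 1) * M

  m^t<M^[p∸1]*b : ∀ {m N M} → 0 < M → N ≤ M → m < dim (suc N) → m ^ t < M ^ (p ∸ 1) * b
  m^t<M^[p∸1]*b {m} {N} {M} 0<M N≤M m<dim = begin-strict
    m ^ t                                    <⟨ ^-monoˡ-< t m<dim ⟩
    dim (suc N) ^ t                          ≡⟨ ^-*-assoc (suc ((p ∸ 1) * suc N)) e t ⟩
    suc ((p ∸ 1) * suc N) ^ (e * t)          ≡⟨ cong (suc ((p ∸ 1) * suc N) ^_) p∸1≡e*t ⟨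
    suc ((p ∸ 1) * suc N) ^ (p ∸ 1)          ≤⟨ ^-monoˡ-≤ (p ∸ 1) (1+[p∸1]*[1+N]≤3*[p∸1]*M 0<M N≤M) ⟩
    (3 * (p ∸ 1) * M) ^ (p ∸ 1)              ≡⟨ ^-distribʳ-* (3 * (p ∸ 1)) M (p ∸ 1) ⟩
    b * M ^ (p ∸ 1)                          ≡⟨ *-comm b _ ⟩
    M ^ (p ∸ 1) * b                          ∎
    where open ≤-Reasoning

  m^t/b≤N^[p∸1] : ∀ {m N} → m < dim (suc N) → (1 * m ^ t) / b ≤ N ^ (p ∸ 1)
  m^t/b≤N^[p∸1] {m} {zero}  m<dim = ≤-reflexive (begin
    (1 * m ^ t) / b   ≡⟨ m<n⇒m/n≡0 m^t<b ⟩
    0                 ≡⟨ 0^n≡0 0<p∸1 ⟨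
    0 ^ (p ∸ 1)       ∎)
    where
    open ≡-Reasoning
    m^t<b : 1 * m ^ t < b
    m^t<b = subst₂ _<_ (sym (*-identityˡ _)) (trans (cong (_* b) (^-zeroˡ (p ∸ 1))) (*-identityˡ b))
                   (m^t<M^[p∸1]*b z<s z≤n m<dim)
  m^t/b≤N^[p∸1] {m} {suc N} m<dim =
    <⇒≤ (m<n*o⇒m/o<n (subst (_< _) (sym (*-identityˡ _)) (m^t<M^[p∸1]*b z<s ≤-refl m<dim)))

lemma6 : (p : ℕ) .{{_ : NonZero p}} → Prime p → p ≢ 2 → (t : ℕ) → IsOrd2 p t →
           CombinatoriallyNice p (InPowersOf2 p) t
lemma6 p p-prime p≢2 t ord = 1 , b , z<s , >-nonZero⁻¹ b , b≢0 , family
  where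
  open Construction p p-prime p≢2 t ord
  family : ∀ m → 0 < m → NiceFamily p (InPowersOf2 p) m ((1 * m ^ t) / b)
  family m 0<m with crossing dim m (dim[0]≤m 0<m) (m<dim[m] m)
  ... | N , dim[N]≤m , m<dim[1+N] = nice-family N m _ dim[N]≤m (m^t/b≤N^[p∸1] m<dim[1+N])
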